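{- In IITT: (1) If $\Gamma\vdash t:T$ then $\Gamma\vdash T$. (2) If $\Gamma\vdash t=t':T$ then $\Gamma\vdash t:T$ and $\Gamma\vdash t':T$.
   Context: Irrelevant Intensional Type Theory (IITT) is defined as follows. Sorts are $\mathsf{Set}_k$ ($k\in\mathbb{N}$), with $\mathsf{Axiom}=\{(\mathsf{Set}_i,\mathsf{Set}_{i+1})\mid i\in\mathbb{N}\}$ and $\mathsf{Rule}=\{(\mathsf{Set}_i,\mathsf{Set}_j,\mathsf{Set}_{\max(i,j)})\mid i,j\in\mathbb{N}\}$. Annotations are $\star\in\{:,\div\}$ (relevant, irrelevant). Expressions: $t,u,T,U ::= s \mid (x\star U)\to^{s,s'}T \mid x \mid \lambda x\star U.\,t \mid t\star u$, where $(x\star U)\to^{s,s'}T$ is a relevant or irrelevant dependent function type annotated with the sort $s$ of its domain and $s'$ of its codomain, and $t\star u$ is relevant application (also written $t\,u$) or irrelevant application $t\div u$. Expressions are taken modulo $\alpha$-equivalence; $[u/x]t$ is capture-avoiding substitution. Contexts: $\Gamma ::= () \mid \Gamma.\,x\star T$ (variables distinct). Resurrection $\Gamma^{\oplus}$ replaces each binding $x\div T$ by $x:T$. Abbreviations: $\Gamma\vdash t\div T$ means $\Gamma^\oplus\vdash t:T$; $\Gamma\vdash t=t'\div T$ means $\Gamma\vdash t\div T$ and $\Gamma\vdash t'\div T$; $\Gamma\vdash T$ means $\Gamma\vdash T:s$ for some sort $s$; $\Gamma\vdash T=T'$ means $\Gamma\vdash T=T':s$ for some $s$. The judgements $\vdash\Gamma$,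 $\Gamma\vdash t:T$, $\Gamma\vdash t=t':T$ are defined mutually inductively by: (contexts) $\vdash()$; from $\vdash\Gamma$ and $\Gamma\vdash T$ infer $\vdash\Gamma.x\star T$. (typing) from $\vdash\Gamma$, $(s,s')\in\mathsf{Axiom}$ infer $\Gamma\vdash s:s'$; from $\Gamma\vdash U:s_1$, $\Gamma.x\star U\vdash T:s_2$, $(s_1,s_2,s_3)\in\mathsf{Rule}$ infer $\Gamma\vdash (x\star U)\to^{s_1,s_2}T:s_3$; from $\vdash\Gamma$ and $(x:U)\in\Gamma$ infer $\Gamma\vdash x:U$ (no variable rule for irrelevant bindings); from $\Gamma.x\star U\vdash t:T$ and $\Gamma\vdash (x\star U)\to^{s,s'}T$ infer $\Gamma\vdash \lambda x\star U.t:(x\star U)\to^{s,s'}T$; from $\Gamma\vdash t:(x\star U)\to^{s,s'}T$ and $\Gamma\vdash u\star U$ infer $\Gamma\vdash t\star u:[u/x]T$; from $\Gamma\vdash t:T$ and $\Gamma\vdash T=T'$ infer $\Gamma\vdash t:T'$. (equality) $\beta$: from $\Gamma.x\star U\vdash t:T$ and $\Gamma\vdash u\star U$ infer $\Gamma\vdash(\lambda x\star U.t)\star u=[u/x]t:[u/x]T$; $\eta$: from $\Gamma\vdash t:(x\star U)\to^{s,s'}T$ infer $\Gamma\vdash t=\lambda x\star U.(t\star x):(x\star U)\to^{s,s'}T$; reflexivity, symmetry, transitivity; from $\Gamma\vdash U=U':s_1$, $\Gamma.x\star U\vdash T=T':s_2$, $(s_1,s_2,s_3)\in\mathsf{Rule}$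 infer $\Gamma\vdash (x\star U)\to^{s_1,s_2}T=(x\star U')\to^{s_1,s_2}T':s_3$; from $\Gamma\vdash U=U':s_1$, $\Gamma.x\star U\vdash T:s_2$, $\Gamma.x\star U\vdash t=t':T$ infer $\Gamma\vdash\lambda x\star U.t=\lambda x\star U'.t':(x\star U)\to^{s_1,s_2}T$; from $\Gamma\vdash t=t':(x\star U)\to^{s,s'}T$ and $\Gamma\vdash u=u'\star U$ infer $\Gamma\vdash t\star u=t'\star u':[u/x]T$; from $\Gamma\vdash t=t':T$ and $\Gamma\vdash T=T'$ infer $\Gamma\vdash t=t':T'$. -}

module Defs where

open import Data.Nat using (ℕ; zero; suc; _⊔_)
open import Data.Product using (Σ; _×_; _,_)

data Ann : Set where
  rel irr : Ann

-- Expressions, with de Bruijn indices (this is exactly the quotient by α-equivalence).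
-- Sorts Set_k are represented by their level k : ℕ.
data Tm : Set where
  sort : ℕ → Tm
  pi   : Ann → ℕ → ℕ → Tm → Tm → Tm      -- pi ⋆ s s' U T  =  (x ⋆ U) →^{Set_s , Set_s'} T   (T binds x)
  var  : ℕ → Tm
  lam  : Ann → Tm → Tm → Tm
  app  : Ann → Tm → Tm → Tm

liftRen : (ℕ → ℕ) → ℕ → ℕ
liftRen ρ zero    = zero
liftRen ρ (suc n) = suc (ρ n)

ren : (ℕ → ℕ) → Tm → Tm
ren ρ (sort k)        = sort k
ren ρ (pi a s s' U T) = pi a s s' (ren ρ U) (ren (liftRen ρ) T)
ren ρ (var n)         = var (ρ n)
ren ρ (lam a U t)     = lam a (ren ρ U) (ren (liftRen ρ) t)
ren ρ (app a t u)     = app a (ren ρ t) (ren ρ u)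

wk : Tm → Tm
wk = ren suc

liftSub : (ℕ → Tm) → ℕ → Tm
liftSub σ zero    = var zero
liftSub σ (suc n) = wk (σ n)

sub : (ℕ → Tm) → Tm → Tm
sub σ (sort k)        = sort k
sub σ (pi a s s' U T) = pi a s s' (sub σ U) (sub (liftSub σ) T)
sub σ (var n)         = σ n
sub σ (lam a U t)     = lam a (sub σ U) (sub (liftSub σ) t)
sub σ (app a t u)     = app a (sub σ t) (sub σ u)

single : Tm → ℕ → Tm
single u zero    = u
single u (suc n) = var n

_[_] : Tm → Tm → Tm
t [ u ] = sub (single u) t

data Ctx : Set where
  ε   : Ctx
  _▸_ : Ctx → Ann × Tm → Ctx

_⊕ : Ctx → Ctx
ε ⊕            = ε
(Γ ▸ (a , T)) ⊕ = (Γ ⊕) ▸ (rel , T)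

-- (x : U) ∈ Γ  with x a relevant binding (type weakened to live in Γ)
data _∋_∶_ : Ctx → ℕ → Tm → Set where
  here  : ∀ {Γ U} → (Γ ▸ (rel , U)) ∋ zero ∶ wk U
  there : ∀ {Γ b n U} → Γ ∋ n ∶ U → (Γ ▸ b) ∋ suc n ∶ wk U

infix 4 ⊢_ _⊢_∶_ _⊢_≡_∶_ _⊢_∶[_]_ _⊢_≡_∶[_]_

mutual
  data ⊢_ : Ctx → Set where
    ⊢ε : ⊢ ε
    ⊢▸ : ∀ {Γ a T s} → ⊢ Γ → Γ ⊢ T ∶ sort s → ⊢ (Γ ▸ (a , T))

  data _⊢_∶[_]_ : Ctx → Tm → Ann → Tm → Set where
    ∶rel : ∀ {Γ u U} → Γ ⊢ u ∶ U → Γ ⊢ u ∶[ rel ] U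
    ∶irr : ∀ {Γ u U} → (Γ ⊕) ⊢ u ∶ U → Γ ⊢ u ∶[ irr ] U

  data _⊢_≡_∶[_]_ : Ctx → Tm → Tm → Ann → Tm → Set where
    ≡rel : ∀ {Γ u u' U} → Γ ⊢ u ≡ u' ∶ U → Γ ⊢ u ≡ u' ∶[ rel ] U
    ≡irr : ∀ {Γ u u' U} → (Γ ⊕) ⊢ u ∶ U → (Γ ⊕) ⊢ u' ∶ U → Γ ⊢ u ≡ u' ∶[ irr ] U

  data _⊢_∶_ : Ctx → Tm → Tm → Set where
    ty-sort : ∀ {Γ i} → ⊢ Γ → Γ ⊢ sort i ∶ sort (suc i)
    ty-pi   : ∀ {Γ a s₁ s₂ U T} → Γ ⊢ U ∶ sort s₁ → (Γ ▸ (a , U)) ⊢ T ∶ sort s₂ →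
              Γ ⊢ pi a s₁ s₂ U T ∶ sort (s₁ ⊔ s₂)
    ty-var  : ∀ {Γ x U} → ⊢ Γ → Γ ∋ x ∶ U → Γ ⊢ var x ∶ U
    ty-lam  : ∀ {Γ a s s' s'' U T t} → (Γ ▸ (a , U)) ⊢ t ∶ T →
              Γ ⊢ pi a s s' U T ∶ sort s'' → Γ ⊢ lam a U t ∶ pi a s s' U T
    ty-app  : ∀ {Γ a s s' U T t u} → Γ ⊢ t ∶ pi a s s' U T → Γ ⊢ u ∶[ a ] U →
              Γ ⊢ app a t u ∶ T [ u ]
    ty-conv : ∀ {Γ t T T' s} → Γ ⊢ t ∶ T → Γ ⊢ T ≡ T' ∶ sort s → Γ ⊢ t ∶ T'

  data _⊢_≡_∶_ : Ctx → Tm → Tm → Tm → Set where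
    eq-β     : ∀ {Γ a U T t u} → (Γ ▸ (a , U)) ⊢ t ∶ T → Γ ⊢ u ∶[ a ] U →
               Γ ⊢ app a (lam a U t) u ≡ t [ u ] ∶ T [ u ]
    eq-η     : ∀ {Γ a s s' U T t} → Γ ⊢ t ∶ pi a s s' U T →
               Γ ⊢ t ≡ lam a U (app a (wk t) (var zero)) ∶ pi a s s' U T
    eq-refl  : ∀ {Γ t T} → Γ ⊢ t ∶ T → Γ ⊢ t ≡ t ∶ T
    eq-sym   : ∀ {Γ t t' T} → Γ ⊢ t ≡ t' ∶ T → Γ ⊢ t' ≡ t ∶ T
    eq-trans : ∀ {Γ t t' t'' T} → Γ ⊢ t ≡ t' ∶ T → Γ ⊢ t' ≡ t'' ∶ T → Γ ⊢ t ≡ t'' ∶ T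
    eq-pi    : ∀ {Γ a s₁ s₂ U U' T T'} → Γ ⊢ U ≡ U' ∶ sort s₁ →
               (Γ ▸ (a , U)) ⊢ T ≡ T' ∶ sort s₂ →
               Γ ⊢ pi a s₁ s₂ U T ≡ pi a s₁ s₂ U' T' ∶ sort (s₁ ⊔ s₂)
    eq-lam   : ∀ {Γ a s₁ s₂ U U' T t t'} → Γ ⊢ U ≡ U' ∶ sort s₁ →
               (Γ ▸ (a , U)) ⊢ T ∶ sort s₂ → (Γ ▸ (a , U)) ⊢ t ≡ t' ∶ T →
               Γ ⊢ lam a U t ≡ lam a U' t' ∶ pi a s₁ s₂ U T
    eq-app   : ∀ {Γ a s s' U T t t' u u'} → Γ ⊢ t ≡ t' ∶ pi a s s' U T →
               Γ ⊢ u ≡ u' ∶[ a ] U → Γ ⊢ app a t u ≡ app a t' u' ∶ T [ u ]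
    eq-conv  : ∀ {Γ t t' T T' s} → Γ ⊢ t ≡ t' ∶ T → Γ ⊢ T ≡ T' ∶ sort s → Γ ⊢ t ≡ t' ∶ T'

_⊢type_ : Ctx → Tm → Set
Γ ⊢type T = Σ ℕ (λ s → Γ ⊢ T ∶ sort s)

-- Validity cannot be proved directly for the rules as stated: the application
-- and λ rules hide the typings of the domain and codomain of their Π, and
-- recovering them by inversion is not a structural induction.  So we work in
-- an equivalent system ⊢ᴱ whose rules carry these premises.  For ⊢ᴱ the usual
-- chain goes through: renaming (covering weakening and resurrection
-- Γ ⊢ t : T ⇒ Γ⊕ ⊢ t : T), substitution, functionality of substitution with
-- respect to judgemental equality (needed for the codomain of an application
-- of equal functions to equal arguments), context conversion (for the Π and λ
-- congruences), and then validity by induction.  Translating a derivation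
-- into ⊢ᴱ uses validity of ⊢ᴱ itself to supply the missing premises.
module Submission where

open import Defs
open import Data.Nat using (ℕ; zero; suc; _⊔_)
open import Data.Product using (Σ; _×_; _,_; proj₁; proj₂; map; map₂)
open import Function using (id; _∘_)
open import Relation.Binary.PropositionalEquality
  using (refl; sym; trans; cong; cong₂; subst; _≗_; module ≡-Reasoning)
  renaming (_≡_ to _≐_)

liftRen-cong : ∀ {ρ ρ'} → ρ ≗ ρ' → liftRen ρ ≗ liftRen ρ'
liftRen-cong h zero    = refl
liftRen-cong h (suc x) = cong suc (h x)

ren-cong : ∀ {ρ ρ'} → ρ ≗ ρ' → ren ρ ≗ ren ρ'
ren-cong h (sort k)        = refl
ren-cong h (pi a s s' U T) = cong₂ (pi a s s') (ren-cong h U) (ren-cong (liftRen-cong h) T)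
ren-cong h (var n)         = cong var (h n)
ren-cong h (lam a U t)     = cong₂ (lam a) (ren-cong h U) (ren-cong (liftRen-cong h) t)
ren-cong h (app a t u)     = cong₂ (app a) (ren-cong h t) (ren-cong h u)

liftSub-cong : ∀ {σ σ'} → σ ≗ σ' → liftSub σ ≗ liftSub σ'
liftSub-cong h zero    = refl
liftSub-cong h (suc x) = cong wk (h x)

sub-cong : ∀ {σ σ'} → σ ≗ σ' → sub σ ≗ sub σ'
sub-cong h (sort k)        = refl
sub-cong h (pi a s s' U T) = cong₂ (pi a s s') (sub-cong h U) (sub-cong (liftSub-cong h) T)
sub-cong h (var n)         = h n
sub-cong h (lam a U t)     = cong₂ (lam a) (sub-cong h U) (sub-cong (liftSub-cong h) t)
sub-cong h (app a t u)     = cong₂ (app a) (sub-cong h t) (sub-cong h u)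

liftRen-id : liftRen id ≗ id
liftRen-id zero    = refl
liftRen-id (suc x) = refl

liftSub-var : liftSub var ≗ var
liftSub-var zero    = refl
liftSub-var (suc x) = refl

liftRen-∘ : ∀ ρ ρ' → liftRen ρ ∘ liftRen ρ' ≗ liftRen (ρ ∘ ρ')
liftRen-∘ ρ ρ' zero    = refl
liftRen-∘ ρ ρ' (suc x) = refl

liftSub-liftRen : ∀ σ ρ → liftSub σ ∘ liftRen ρ ≗ liftSub (σ ∘ ρ)
liftSub-liftRen σ ρ zero    = refl
liftSub-liftRen σ ρ (suc x) = refl

ren-id : ∀ t → ren id t ≐ t
ren-id (sort k)        = refl
ren-id (pi a s s' U T) = cong₂ (pi a s s') (ren-id U) (trans (ren-cong liftRen-id T) (ren-id T))
ren-id (var n)         = refl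
ren-id (lam a U t)     = cong₂ (lam a) (ren-id U) (trans (ren-cong liftRen-id t) (ren-id t))
ren-id (app a t u)     = cong₂ (app a) (ren-id t) (ren-id u)

sub-id : ∀ t → sub var t ≐ t
sub-id (sort k)        = refl
sub-id (pi a s s' U T) = cong₂ (pi a s s') (sub-id U) (trans (sub-cong liftSub-var T) (sub-id T))
sub-id (var n)         = refl
sub-id (lam a U t)     = cong₂ (lam a) (sub-id U) (trans (sub-cong liftSub-var t) (sub-id t))
sub-id (app a t u)     = cong₂ (app a) (sub-id t) (sub-id u)

ren-ren : ∀ ρ ρ' t → ren ρ (ren ρ' t) ≐ ren (ρ ∘ ρ') t
ren-ren ρ ρ' (sort k)        = refl
ren-ren ρ ρ' (pi a s s' U T) = cong₂ (pi a s s') (ren-ren ρ ρ' U)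
  (trans (ren-ren (liftRen ρ) (liftRen ρ') T) (ren-cong (liftRen-∘ ρ ρ') T))
ren-ren ρ ρ' (var n)         = refl
ren-ren ρ ρ' (lam a U t)     = cong₂ (lam a) (ren-ren ρ ρ' U)
  (trans (ren-ren (liftRen ρ) (liftRen ρ') t) (ren-cong (liftRen-∘ ρ ρ') t))
ren-ren ρ ρ' (app a t u)     = cong₂ (app a) (ren-ren ρ ρ' t) (ren-ren ρ ρ' u)

wk-ren : ∀ ρ A → wk (ren ρ A) ≐ ren (liftRen ρ) (wk A)
wk-ren ρ A = trans (ren-ren suc ρ A) (sym (ren-ren (liftRen ρ) suc A))

ren-liftSub : ∀ ρ σ → ren (liftRen ρ) ∘ liftSub σ ≗ liftSub (ren ρ ∘ σ)
ren-liftSub ρ σ zero    = refl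
ren-liftSub ρ σ (suc x) = sym (wk-ren ρ (σ x))

ren-sub : ∀ ρ σ t → ren ρ (sub σ t) ≐ sub (ren ρ ∘ σ) t
ren-sub ρ σ (sort k)        = refl
ren-sub ρ σ (pi a s s' U T) = cong₂ (pi a s s') (ren-sub ρ σ U)
  (trans (ren-sub (liftRen ρ) (liftSub σ) T) (sub-cong (ren-liftSub ρ σ) T))
ren-sub ρ σ (var n)         = refl
ren-sub ρ σ (lam a U t)     = cong₂ (lam a) (ren-sub ρ σ U)
  (trans (ren-sub (liftRen ρ) (liftSub σ) t) (sub-cong (ren-liftSub ρ σ) t))
ren-sub ρ σ (app a t u)     = cong₂ (app a) (ren-sub ρ σ t) (ren-sub ρ σ u)

sub-ren : ∀ σ ρ t → sub σ (ren ρ t) ≐ sub (σ ∘ ρ) t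
sub-ren σ ρ (sort k)        = refl
sub-ren σ ρ (pi a s s' U T) = cong₂ (pi a s s') (sub-ren σ ρ U)
  (trans (sub-ren (liftSub σ) (liftRen ρ) T) (sub-cong (liftSub-liftRen σ ρ) T))
sub-ren σ ρ (var n)         = refl
sub-ren σ ρ (lam a U t)     = cong₂ (lam a) (sub-ren σ ρ U)
  (trans (sub-ren (liftSub σ) (liftRen ρ) t) (sub-cong (liftSub-liftRen σ ρ) t))
sub-ren σ ρ (app a t u)     = cong₂ (app a) (sub-ren σ ρ t) (sub-ren σ ρ u)

wk-sub : ∀ σ A → wk (sub σ A) ≐ sub (liftSub σ) (wk A)
wk-sub σ A = trans (ren-sub suc σ A) (sym (sub-ren (liftSub σ) suc A))

sub-liftSub : ∀ σ τ → sub (liftSub σ) ∘ liftSub τ ≗ liftSub (sub σ ∘ τ)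
sub-liftSub σ τ zero    = refl
sub-liftSub σ τ (suc x) = sym (wk-sub σ (τ x))

sub-sub : ∀ σ τ t → sub σ (sub τ t) ≐ sub (sub σ ∘ τ) t
sub-sub σ τ (sort k)        = refl
sub-sub σ τ (pi a s s' U T) = cong₂ (pi a s s') (sub-sub σ τ U)
  (trans (sub-sub (liftSub σ) (liftSub τ) T) (sub-cong (sub-liftSub σ τ) T))
sub-sub σ τ (var n)         = refl
sub-sub σ τ (lam a U t)     = cong₂ (lam a) (sub-sub σ τ U)
  (trans (sub-sub (liftSub σ) (liftSub τ) t) (sub-cong (sub-liftSub σ τ) t))
sub-sub σ τ (app a t u)     = cong₂ (app a) (sub-sub σ τ t) (sub-sub σ τ u)

wk-[] : ∀ A u → wk A [ u ] ≐ A
wk-[] A u = trans (sub-ren (single u) suc A) (sub-id A)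

sub-[] : ∀ σ T u → sub σ (T [ u ]) ≐ sub (liftSub σ) T [ sub σ u ]
sub-[] σ T u = begin
  sub σ (sub (single u) T)                        ≡⟨ sub-sub σ (single u) T ⟩
  sub (sub σ ∘ single u) T                        ≡⟨ sub-cong single-liftSub T ⟩
  sub (sub (single (sub σ u)) ∘ liftSub σ) T      ≡⟨ sym (sub-sub (single (sub σ u)) (liftSub σ) T) ⟩
  sub (single (sub σ u)) (sub (liftSub σ) T)      ∎
  where
  open ≡-Reasoning
  single-liftSub : sub σ ∘ single u ≗ sub (single (sub σ u)) ∘ liftSub σ
  single-liftSub zero    = refl
  single-liftSub (suc x) = sym (wk-[] (σ x) (sub σ u))

ren-[] : ∀ ρ T u → ren ρ (T [ u ]) ≐ ren (liftRen ρ) T [ ren ρ u ]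
ren-[] ρ T u = begin
  ren ρ (sub (single u) T)                        ≡⟨ ren-sub ρ (single u) T ⟩
  sub (ren ρ ∘ single u) T                        ≡⟨ sub-cong single-liftRen T ⟩
  sub (single (ren ρ u) ∘ liftRen ρ) T            ≡⟨ sym (sub-ren (single (ren ρ u)) (liftRen ρ) T) ⟩
  sub (single (ren ρ u)) (ren (liftRen ρ) T)      ∎
  where
  open ≡-Reasoning
  single-liftRen : ren ρ ∘ single u ≗ single (ren ρ u) ∘ liftRen ρ
  single-liftRen zero    = refl
  single-liftRen (suc x) = refl

ren-liftRen-suc-[var0] : ∀ T → ren (liftRen suc) T [ var zero ] ≐ T
ren-liftRen-suc-[var0] T =
  trans (sub-ren (single (var zero)) (liftRen suc) T) (trans (sub-cong var0 T) (sub-id T))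
  where
  var0 : single (var zero) ∘ liftRen suc ≗ var
  var0 zero    = refl
  var0 (suc x) = refl

infix 4 ⊢ᴱ_ _⊢ᴱ_∶_ _⊢ᴱ_≡_∶_ _⊢ᴱ_∶[_]_ _⊢ᴱ_≡_∶[_]_

-- The rules of IITT, with the domain and codomain typings of the Π inspected by
-- λ, application, β and the congruences stored as premises.
mutual
  data ⊢ᴱ_ : Ctx → Set where
    ⊢ε : ⊢ᴱ ε
    ⊢▸ : ∀ {Γ a T s} → ⊢ᴱ Γ → Γ ⊢ᴱ T ∶ sort s → ⊢ᴱ (Γ ▸ (a , T))

  data _⊢ᴱ_∶[_]_ : Ctx → Tm → Ann → Tm → Set where
    ∶rel : ∀ {Γ u U} → Γ ⊢ᴱ u ∶ U → Γ ⊢ᴱ u ∶[ rel ] U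
    ∶irr : ∀ {Γ u U} → (Γ ⊕) ⊢ᴱ u ∶ U → Γ ⊢ᴱ u ∶[ irr ] U

  data _⊢ᴱ_≡_∶[_]_ : Ctx → Tm → Tm → Ann → Tm → Set where
    ≡rel : ∀ {Γ u u' U} → Γ ⊢ᴱ u ≡ u' ∶ U → Γ ⊢ᴱ u ≡ u' ∶[ rel ] U
    ≡irr : ∀ {Γ u u' U} → (Γ ⊕) ⊢ᴱ u ∶ U → (Γ ⊕) ⊢ᴱ u' ∶ U → Γ ⊢ᴱ u ≡ u' ∶[ irr ] U

  data _⊢ᴱ_∶_ : Ctx → Tm → Tm → Set where
    ty-sort : ∀ {Γ i} → ⊢ᴱ Γ → Γ ⊢ᴱ sort i ∶ sort (suc i)
    ty-pi   : ∀ {Γ a s₁ s₂ U T} → Γ ⊢ᴱ U ∶ sort s₁ → (Γ ▸ (a , U)) ⊢ᴱ T ∶ sort s₂ →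
              Γ ⊢ᴱ pi a s₁ s₂ U T ∶ sort (s₁ ⊔ s₂)
    ty-var  : ∀ {Γ x U} → ⊢ᴱ Γ → Γ ∋ x ∶ U → Γ ⊢ᴱ var x ∶ U
    ty-lam  : ∀ {Γ a s s' U T t} → Γ ⊢ᴱ U ∶ sort s → (Γ ▸ (a , U)) ⊢ᴱ T ∶ sort s' →
              (Γ ▸ (a , U)) ⊢ᴱ t ∶ T → Γ ⊢ᴱ lam a U t ∶ pi a s s' U T
    ty-app  : ∀ {Γ a s s' U T t u} → Γ ⊢ᴱ U ∶ sort s → (Γ ▸ (a , U)) ⊢ᴱ T ∶ sort s' →
              Γ ⊢ᴱ t ∶ pi a s s' U T → Γ ⊢ᴱ u ∶[ a ] U → Γ ⊢ᴱ app a t u ∶ T [ u ]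
    ty-conv : ∀ {Γ t T T' s} → Γ ⊢ᴱ t ∶ T → Γ ⊢ᴱ T ≡ T' ∶ sort s → Γ ⊢ᴱ t ∶ T'

  data _⊢ᴱ_≡_∶_ : Ctx → Tm → Tm → Tm → Set where
    eq-β     : ∀ {Γ a s U T t u} → Γ ⊢ᴱ U ∶ sort s → (Γ ▸ (a , U)) ⊢ᴱ t ∶ T →
               Γ ⊢ᴱ u ∶[ a ] U → Γ ⊢ᴱ app a (lam a U t) u ≡ t [ u ] ∶ T [ u ]
    eq-η     : ∀ {Γ a s s' U T t} → Γ ⊢ᴱ t ∶ pi a s s' U T →
               Γ ⊢ᴱ t ≡ lam a U (app a (wk t) (var zero)) ∶ pi a s s' U T
    eq-refl  : ∀ {Γ t T} → Γ ⊢ᴱ t ∶ T → Γ ⊢ᴱ t ≡ t ∶ T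
    eq-sym   : ∀ {Γ t t' T} → Γ ⊢ᴱ t ≡ t' ∶ T → Γ ⊢ᴱ t' ≡ t ∶ T
    eq-trans : ∀ {Γ t t' t'' T} → Γ ⊢ᴱ t ≡ t' ∶ T → Γ ⊢ᴱ t' ≡ t'' ∶ T → Γ ⊢ᴱ t ≡ t'' ∶ T
    eq-pi    : ∀ {Γ a s₁ s₂ U U' T T'} → Γ ⊢ᴱ U ∶ sort s₁ → Γ ⊢ᴱ U ≡ U' ∶ sort s₁ →
               (Γ ▸ (a , U)) ⊢ᴱ T ≡ T' ∶ sort s₂ →
               Γ ⊢ᴱ pi a s₁ s₂ U T ≡ pi a s₁ s₂ U' T' ∶ sort (s₁ ⊔ s₂)
    eq-lam   : ∀ {Γ a s₁ s₂ U U' T t t'} → Γ ⊢ᴱ U ∶ sort s₁ → Γ ⊢ᴱ U ≡ U' ∶ sort s₁ →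
               (Γ ▸ (a , U)) ⊢ᴱ T ∶ sort s₂ → (Γ ▸ (a , U)) ⊢ᴱ t ≡ t' ∶ T →
               Γ ⊢ᴱ lam a U t ≡ lam a U' t' ∶ pi a s₁ s₂ U T
    eq-app   : ∀ {Γ a s s' U T t t' u u'} → Γ ⊢ᴱ U ∶ sort s → (Γ ▸ (a , U)) ⊢ᴱ T ∶ sort s' →
               Γ ⊢ᴱ t ≡ t' ∶ pi a s s' U T → Γ ⊢ᴱ u ≡ u' ∶[ a ] U →
               Γ ⊢ᴱ app a t u ≡ app a t' u' ∶ T [ u ]
    eq-conv  : ∀ {Γ t t' T T' s} → Γ ⊢ᴱ t ≡ t' ∶ T → Γ ⊢ᴱ T ≡ T' ∶ sort s → Γ ⊢ᴱ t ≡ t' ∶ T'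

_⊢ᴱtype_ : Ctx → Tm → Set
Γ ⊢ᴱtype T = Σ ℕ λ s → Γ ⊢ᴱ T ∶ sort s

cast-ty : ∀ {Γ t T T'} → T ≐ T' → Γ ⊢ᴱ t ∶ T → Γ ⊢ᴱ t ∶ T'
cast-ty refl d = d

cast-tm : ∀ {Γ t t' T} → t ≐ t' → Γ ⊢ᴱ t ∶ T → Γ ⊢ᴱ t' ∶ T
cast-tm refl d = d

cast-arg : ∀ {Γ t T T' a} → T ≐ T' → Γ ⊢ᴱ t ∶[ a ] T → Γ ⊢ᴱ t ∶[ a ] T'
cast-arg refl d = d

cast-eq : ∀ {Γ t₁ t₂ u₁ u₂ T T'} → t₁ ≐ t₂ → u₁ ≐ u₂ → T ≐ T' →
          Γ ⊢ᴱ t₁ ≡ u₁ ∶ T → Γ ⊢ᴱ t₂ ≡ u₂ ∶ T'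
cast-eq refl refl refl e = e

ctx-wf : ∀ {Γ t T} → Γ ⊢ᴱ t ∶ T → ⊢ᴱ Γ
ctx-wf (ty-sort p)       = p
ctx-wf (ty-pi dU _)      = ctx-wf dU
ctx-wf (ty-var p _)      = p
ctx-wf (ty-lam dU _ _)   = ctx-wf dU
ctx-wf (ty-app dU _ _ _) = ctx-wf dU
ctx-wf (ty-conv d _)     = ctx-wf d

ctx-wf-≡ : ∀ {Γ t t' T} → Γ ⊢ᴱ t ≡ t' ∶ T → ⊢ᴱ Γ
ctx-wf-≡ (eq-β dU _ _)     = ctx-wf dU
ctx-wf-≡ (eq-η d)          = ctx-wf d
ctx-wf-≡ (eq-refl d)       = ctx-wf d
ctx-wf-≡ (eq-sym e)        = ctx-wf-≡ e
ctx-wf-≡ (eq-trans e _)    = ctx-wf-≡ e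
ctx-wf-≡ (eq-pi dU _ _)    = ctx-wf dU
ctx-wf-≡ (eq-lam dU _ _ _) = ctx-wf dU
ctx-wf-≡ (eq-app dU _ _ _) = ctx-wf dU
ctx-wf-≡ (eq-conv e _)     = ctx-wf-≡ e

▸-wf-inv : ∀ {Γ a U} → ⊢ᴱ (Γ ▸ (a , U)) → Γ ⊢ᴱtype U
▸-wf-inv (⊢▸ _ dU) = _ , dU

pi-inv : ∀ {Γ a s s' U T X} → Γ ⊢ᴱ pi a s s' U T ∶ X →
         (Γ ⊢ᴱ U ∶ sort s) × ((Γ ▸ (a , U)) ⊢ᴱ T ∶ sort s')
pi-inv (ty-pi dU dT) = dU , dT
pi-inv (ty-conv d _) = pi-inv d

data _∋_∶_⟨_⟩ : Ctx → ℕ → Tm → Ann → Set where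
  here  : ∀ {Γ a U} → (Γ ▸ (a , U)) ∋ zero ∶ wk U ⟨ a ⟩
  there : ∀ {Γ b n U a} → Γ ∋ n ∶ U ⟨ a ⟩ → (Γ ▸ b) ∋ suc n ∶ wk U ⟨ a ⟩

∋rel⇒∋ : ∀ {Γ x A} → Γ ∋ x ∶ A ⟨ rel ⟩ → Γ ∋ x ∶ A
∋rel⇒∋ here      = here
∋rel⇒∋ (there x) = there (∋rel⇒∋ x)

∋⇒∋rel : ∀ {Γ x A} → Γ ∋ x ∶ A → Γ ∋ x ∶ A ⟨ rel ⟩
∋⇒∋rel here      = here
∋⇒∋rel (there x) = there (∋⇒∋rel x)

∋⟨⟩⇒∋⊕ : ∀ {Γ x A a} → Γ ∋ x ∶ A ⟨ a ⟩ → (Γ ⊕) ∋ x ∶ A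
∋⟨⟩⇒∋⊕ here      = here
∋⟨⟩⇒∋⊕ (there x) = there (∋⟨⟩⇒∋⊕ x)

∋⇒∋⊕ : ∀ {Γ x A} → Γ ∋ x ∶ A → (Γ ⊕) ∋ x ∶ A
∋⇒∋⊕ = ∋⟨⟩⇒∋⊕ ∘ ∋⇒∋rel

∋⊕-inv : ∀ Γ {x A a} → (Γ ⊕) ∋ x ∶ A ⟨ a ⟩ → (a ≐ rel) × Σ Ann λ a' → Γ ∋ x ∶ A ⟨ a' ⟩
∋⊕-inv ε ()
∋⊕-inv (Γ ▸ (b , B)) here = refl , (b , here)
∋⊕-inv (Γ ▸ (b , B)) (there x) = map id (map id there) (∋⊕-inv Γ x)

⊕-idem : ∀ Γ → (Γ ⊕) ⊕ ≐ Γ ⊕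
⊕-idem ε             = refl
⊕-idem (Γ ▸ (a , T)) = cong (_▸ (rel , T)) (⊕-idem Γ)

_∋_∶[_]_ : Ctx → ℕ → Ann → Tm → Set
Δ ∋ y ∶[ rel ] B = Δ ∋ y ∶ B
Δ ∋ y ∶[ irr ] B = (Δ ⊕) ∋ y ∶ B

∋⟨⟩⇒∋[] : ∀ {Γ x A a} → Γ ∋ x ∶ A ⟨ a ⟩ → Γ ∋ x ∶[ a ] A
∋⟨⟩⇒∋[] {a = rel} x = ∋rel⇒∋ x
∋⟨⟩⇒∋[] {a = irr} x = ∋⟨⟩⇒∋⊕ x

∋[]⇒∋⊕ : ∀ {Δ y B a} → Δ ∋ y ∶[ a ] B → (Δ ⊕) ∋ y ∶ B
∋[]⇒∋⊕ {a = rel} y = ∋⇒∋⊕ y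
∋[]⇒∋⊕ {a = irr} y = y

∋[]-⊕ : ∀ {Δ y B a} → Δ ∋ y ∶[ a ] B → (Δ ⊕) ∋ y ∶[ a ] B
∋[]-⊕ {a = rel} y = ∋⇒∋⊕ y
∋[]-⊕ {a = irr} y = ∋⇒∋⊕ y

∋[]-here : ∀ {Δ a B} → (Δ ▸ (a , B)) ∋ zero ∶[ a ] wk B
∋[]-here {a = rel} = here
∋[]-here {a = irr} = here

∋[]-there : ∀ {Δ b y B a} → Δ ∋ y ∶[ a ] B → (Δ ▸ b) ∋ suc y ∶[ a ] wk B
∋[]-there {a = rel} y = there y
∋[]-there {a = irr} y = there y

-- Well-formedness of Δ ⊕ is recorded separately because it is derived from
-- resurrection, which is itself a renaming.
record _⊢ʳ_∶_ (Δ : Ctx) (ρ : ℕ → ℕ) (Γ : Ctx) : Set where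
  constructor mkRen
  field
    ren-wf  : ⊢ᴱ Δ
    ren-wf⊕ : ⊢ᴱ (Δ ⊕)
    ren-∋   : ∀ {x A a} → Γ ∋ x ∶ A ⟨ a ⟩ → Δ ∋ ρ x ∶[ a ] ren ρ A
open _⊢ʳ_∶_

⊢ʳ-⊕ˡ : ∀ {Δ ρ Γ} → Δ ⊢ʳ ρ ∶ Γ → (Δ ⊕) ⊢ʳ ρ ∶ Γ
⊢ʳ-⊕ˡ {Δ} r = mkRen (ren-wf⊕ r) (subst ⊢ᴱ_ (sym (⊕-idem Δ)) (ren-wf⊕ r)) (∋[]-⊕ ∘ ren-∋ r)

⊢ʳ-⊕ : ∀ {Δ ρ Γ} → Δ ⊢ʳ ρ ∶ Γ → (Δ ⊕) ⊢ʳ ρ ∶ (Γ ⊕)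
⊢ʳ-⊕ {Δ} {ρ} {Γ} r = mkRen (ren-wf⊕ r) (subst ⊢ᴱ_ (sym (⊕-idem Δ)) (ren-wf⊕ r)) ∋⊕
  where
  ∋⊕ : ∀ {x A a} → (Γ ⊕) ∋ x ∶ A ⟨ a ⟩ → (Δ ⊕) ∋ ρ x ∶[ a ] ren ρ A
  ∋⊕ x with ∋⊕-inv Γ x
  ... | refl , (_ , y) = ∋[]⇒∋⊕ (ren-∋ r y)

⊢ʳ-lift : ∀ {Δ ρ Γ a U s s'} → Δ ⊢ʳ ρ ∶ Γ →
          Δ ⊢ᴱ ren ρ U ∶ sort s → (Δ ⊕) ⊢ᴱ ren ρ U ∶ sort s' →
          (Δ ▸ (a , ren ρ U)) ⊢ʳ liftRen ρ ∶ (Γ ▸ (a , U))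
⊢ʳ-lift {Δ} {ρ} {Γ} {a} {U} r dU dU⊕ = mkRen (⊢▸ (ren-wf r) dU) (⊢▸ (ren-wf⊕ r) dU⊕) ∋lift
  where
  ∋lift : ∀ {x A b} → (Γ ▸ (a , U)) ∋ x ∶ A ⟨ b ⟩ →
          (Δ ▸ (a , ren ρ U)) ∋ liftRen ρ x ∶[ b ] ren (liftRen ρ) A
  ∋lift here = subst ((Δ ▸ (a , ren ρ U)) ∋ zero ∶[ a ]_) (wk-ren ρ U) ∋[]-here
  ∋lift {b = b} (there {U = A} x) =
    subst ((Δ ▸ (a , ren ρ U)) ∋ _ ∶[ b ]_) (wk-ren ρ A) (∋[]-there (ren-∋ r x))

mutual
  ⊢ren : ∀ {Δ ρ Γ t T} → Δ ⊢ʳ ρ ∶ Γ → Γ ⊢ᴱ t ∶ T → Δ ⊢ᴱ ren ρ t ∶ ren ρ T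
  ⊢ren r (ty-sort _)      = ty-sort (ren-wf r)
  ⊢ren r (ty-pi dU dT)    = ty-pi (⊢ren r dU) (⊢ren (⊢ʳ-lift r (⊢ren r dU) (⊢ren (⊢ʳ-⊕ˡ r) dU)) dT)
  ⊢ren r (ty-var _ x)     = ty-var (ren-wf r) (ren-∋ r (∋⇒∋rel x))
  ⊢ren r (ty-lam dU dT d) =
    let r' = ⊢ʳ-lift r (⊢ren r dU) (⊢ren (⊢ʳ-⊕ˡ r) dU)
    in ty-lam (⊢ren r dU) (⊢ren r' dT) (⊢ren r' d)
  ⊢ren {ρ = ρ} r (ty-app {T = T} {u = u} dU dT dt du) =
    let r' = ⊢ʳ-lift r (⊢ren r dU) (⊢ren (⊢ʳ-⊕ˡ r) dU)
    in cast-ty (sym (ren-[] ρ T u)) (ty-app (⊢ren r dU) (⊢ren r' dT) (⊢ren r dt) (⊢ren-arg r du))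
  ⊢ren r (ty-conv d e)    = ty-conv (⊢ren r d) (⊢ren-≡ r e)

  ⊢ren-arg : ∀ {Δ ρ Γ t T a} → Δ ⊢ʳ ρ ∶ Γ → Γ ⊢ᴱ t ∶[ a ] T → Δ ⊢ᴱ ren ρ t ∶[ a ] ren ρ T
  ⊢ren-arg r (∶rel d) = ∶rel (⊢ren r d)
  ⊢ren-arg r (∶irr d) = ∶irr (⊢ren (⊢ʳ-⊕ r) d)

  ⊢ren-≡arg : ∀ {Δ ρ Γ t t' T a} → Δ ⊢ʳ ρ ∶ Γ → Γ ⊢ᴱ t ≡ t' ∶[ a ] T →
              Δ ⊢ᴱ ren ρ t ≡ ren ρ t' ∶[ a ] ren ρ T
  ⊢ren-≡arg r (≡rel e)    = ≡rel (⊢ren-≡ r e)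
  ⊢ren-≡arg r (≡irr d d') = ≡irr (⊢ren (⊢ʳ-⊕ r) d) (⊢ren (⊢ʳ-⊕ r) d')

  ⊢ren-≡ : ∀ {Δ ρ Γ t t' T} → Δ ⊢ʳ ρ ∶ Γ → Γ ⊢ᴱ t ≡ t' ∶ T → Δ ⊢ᴱ ren ρ t ≡ ren ρ t' ∶ ren ρ T
  ⊢ren-≡ {ρ = ρ} r (eq-β {T = T} {t = t} {u = u} dU d du) =
    let r' = ⊢ʳ-lift r (⊢ren r dU) (⊢ren (⊢ʳ-⊕ˡ r) dU)
    in cast-eq refl (sym (ren-[] ρ t u)) (sym (ren-[] ρ T u))
               (eq-β (⊢ren r dU) (⊢ren r' d) (⊢ren-arg r du))
  ⊢ren-≡ {ρ = ρ} r (eq-η {t = t} d) =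
    cast-eq refl (cong (λ f → lam _ _ (app _ f (var zero))) (wk-ren ρ t)) refl (eq-η (⊢ren r d))
  ⊢ren-≡ r (eq-refl d)      = eq-refl (⊢ren r d)
  ⊢ren-≡ r (eq-sym e)       = eq-sym (⊢ren-≡ r e)
  ⊢ren-≡ r (eq-trans e e')  = eq-trans (⊢ren-≡ r e) (⊢ren-≡ r e')
  ⊢ren-≡ r (eq-pi dU eU eT) =
    let r' = ⊢ʳ-lift r (⊢ren r dU) (⊢ren (⊢ʳ-⊕ˡ r) dU)
    in eq-pi (⊢ren r dU) (⊢ren-≡ r eU) (⊢ren-≡ r' eT)
  ⊢ren-≡ r (eq-lam dU eU dT et) =
    let r' = ⊢ʳ-lift r (⊢ren r dU) (⊢ren (⊢ʳ-⊕ˡ r) dU)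
    in eq-lam (⊢ren r dU) (⊢ren-≡ r eU) (⊢ren r' dT) (⊢ren-≡ r' et)
  ⊢ren-≡ {ρ = ρ} r (eq-app {T = T} {u = u} dU dT et eu) =
    let r' = ⊢ʳ-lift r (⊢ren r dU) (⊢ren (⊢ʳ-⊕ˡ r) dU)
    in cast-eq refl refl (sym (ren-[] ρ T u))
               (eq-app (⊢ren r dU) (⊢ren r' dT) (⊢ren-≡ r et) (⊢ren-≡arg r eu))
  ⊢ren-≡ r (eq-conv e e')   = eq-conv (⊢ren-≡ r e) (⊢ren-≡ r e')

⊢ʳ-id⊕ : ∀ {Γ} → ⊢ᴱ (Γ ⊕) → (Γ ⊕) ⊢ʳ id ∶ Γ
⊢ʳ-id⊕ {Γ} p = mkRen p (subst ⊢ᴱ_ (sym (⊕-idem Γ)) p) ∋id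
  where
  ∋id : ∀ {x A a} → Γ ∋ x ∶ A ⟨ a ⟩ → (Γ ⊕) ∋ x ∶[ a ] ren id A
  ∋id {x} {A} {a} y = subst (_ ∋ x ∶[ a ]_) (sym (ren-id A)) (∋[]-⊕ (∋⟨⟩⇒∋[] y))

resurrect-into : ∀ {Γ t T} → ⊢ᴱ (Γ ⊕) → Γ ⊢ᴱ t ∶ T → (Γ ⊕) ⊢ᴱ t ∶ T
resurrect-into {t = t} {T} p d = cast-tm (ren-id t) (cast-ty (ren-id T) (⊢ren (⊢ʳ-id⊕ p) d))

resurrect-wf : ∀ {Γ} → ⊢ᴱ Γ → ⊢ᴱ (Γ ⊕)
resurrect-wf ⊢ε       = ⊢ε
resurrect-wf (⊢▸ p d) = ⊢▸ (resurrect-wf p) (resurrect-into (resurrect-wf p) d)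

resurrect : ∀ {Γ t T} → Γ ⊢ᴱ t ∶ T → (Γ ⊕) ⊢ᴱ t ∶ T
resurrect d = resurrect-into (resurrect-wf (ctx-wf d)) d

resurrect-≡ : ∀ {Γ t t' T} → Γ ⊢ᴱ t ≡ t' ∶ T → (Γ ⊕) ⊢ᴱ t ≡ t' ∶ T
resurrect-≡ {t = t} {t'} {T} e =
  cast-eq (ren-id t) (ren-id t') (ren-id T) (⊢ren-≡ (⊢ʳ-id⊕ (resurrect-wf (ctx-wf-≡ e))) e)

⊢ʳ-wk : ∀ {Γ a B} → ⊢ᴱ (Γ ▸ (a , B)) → (Γ ▸ (a , B)) ⊢ʳ suc ∶ Γ
⊢ʳ-wk (⊢▸ p dB) =
  mkRen (⊢▸ p dB) (⊢▸ (resurrect-wf p) (resurrect dB)) (∋[]-there ∘ ∋⟨⟩⇒∋[])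

⊢wk : ∀ {Γ a B t T} → ⊢ᴱ (Γ ▸ (a , B)) → Γ ⊢ᴱ t ∶ T → (Γ ▸ (a , B)) ⊢ᴱ wk t ∶ wk T
⊢wk p = ⊢ren (⊢ʳ-wk p)

⊢wk-≡ : ∀ {Γ a B t t' T} → ⊢ᴱ (Γ ▸ (a , B)) → Γ ⊢ᴱ t ≡ t' ∶ T →
        (Γ ▸ (a , B)) ⊢ᴱ wk t ≡ wk t' ∶ wk T
⊢wk-≡ p = ⊢ren-≡ (⊢ʳ-wk p)

⊢var-arg : ∀ {Γ x A a} → ⊢ᴱ Γ → Γ ∋ x ∶ A ⟨ a ⟩ → Γ ⊢ᴱ var x ∶[ a ] A
⊢var-arg {a = rel} p x = ∶rel (ty-var p (∋rel⇒∋ x))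
⊢var-arg {a = irr} p x = ∶irr (ty-var (resurrect-wf p) (∋⟨⟩⇒∋⊕ x))

record _⊢ˢ_∶_ (Δ : Ctx) (σ : ℕ → Tm) (Γ : Ctx) : Set where
  constructor mkSub
  field
    sub-wf : ⊢ᴱ Δ
    sub-∋  : ∀ {x A a} → Γ ∋ x ∶ A ⟨ a ⟩ → Δ ⊢ᴱ σ x ∶[ a ] sub σ A
open _⊢ˢ_∶_

⊢ˢ-⊕ : ∀ {Δ σ Γ} → Δ ⊢ˢ σ ∶ Γ → (Δ ⊕) ⊢ˢ σ ∶ (Γ ⊕)
⊢ˢ-⊕ {Δ} {σ} {Γ} S = mkSub (resurrect-wf (sub-wf S)) ∋⊕
  where
  as-rel : ∀ {u A a} → Δ ⊢ᴱ u ∶[ a ] A → (Δ ⊕) ⊢ᴱ u ∶[ rel ] A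
  as-rel (∶rel d) = ∶rel (resurrect d)
  as-rel (∶irr d) = ∶rel d
  ∋⊕ : ∀ {x A a} → (Γ ⊕) ∋ x ∶ A ⟨ a ⟩ → (Δ ⊕) ⊢ᴱ σ x ∶[ a ] sub σ A
  ∋⊕ x with ∋⊕-inv Γ x
  ... | refl , (_ , y) = as-rel (sub-∋ S y)

-- The new binding may be given any type V convertible to the substituted one,
-- which is what context conversion needs.
⊢ˢ-lift : ∀ {Δ σ Γ a U V s} → Δ ⊢ˢ σ ∶ Γ → Δ ⊢ᴱ V ∶ sort s → Δ ⊢ᴱ V ≡ sub σ U ∶ sort s →
          (Δ ▸ (a , V)) ⊢ˢ liftSub σ ∶ (Γ ▸ (a , U))
⊢ˢ-lift {Δ} {σ} {Γ} {a} {U} {V} S dV eV = mkSub p ∋lift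
  where
  p : ⊢ᴱ (Δ ▸ (a , V))
  p = ⊢▸ (sub-wf S) dV
  p⊕ : ⊢ᴱ ((Δ ⊕) ▸ (rel , V))
  p⊕ = ⊢▸ (resurrect-wf (sub-wf S)) (resurrect dV)
  wk-arg : ∀ {u A b} → Δ ⊢ᴱ u ∶[ b ] A → (Δ ▸ (a , V)) ⊢ᴱ wk u ∶[ b ] wk A
  wk-arg (∶rel d) = ∶rel (⊢wk p d)
  wk-arg (∶irr d) = ∶irr (⊢wk p⊕ d)
  ∋lift : ∀ {x A b} → (Γ ▸ (a , U)) ∋ x ∶ A ⟨ b ⟩ →
          (Δ ▸ (a , V)) ⊢ᴱ liftSub σ x ∶[ b ] sub (liftSub σ) A
  ∋lift {b = rel} here = cast-arg (wk-sub σ U) (∶rel (ty-conv (ty-var p here) (⊢wk-≡ p eV)))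
  ∋lift {b = irr} here =
    cast-arg (wk-sub σ U) (∶irr (ty-conv (ty-var p⊕ here) (⊢wk-≡ p⊕ (resurrect-≡ eV))))
  ∋lift (there {U = A} x) = cast-arg (wk-sub σ A) (wk-arg (sub-∋ S x))

mutual
  ⊢sub : ∀ {Δ σ Γ t T} → Δ ⊢ˢ σ ∶ Γ → Γ ⊢ᴱ t ∶ T → Δ ⊢ᴱ sub σ t ∶ sub σ T
  ⊢sub S (ty-sort _)   = ty-sort (sub-wf S)
  ⊢sub S (ty-pi dU dT) = ty-pi (⊢sub S dU) (⊢sub (⊢ˢ-lift S (⊢sub S dU) (eq-refl (⊢sub S dU))) dT)
  ⊢sub S (ty-var _ x) with sub-∋ S (∋⇒∋rel x)
  ... | ∶rel d = d
  ⊢sub S (ty-lam dU dT d) =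
    let S' = ⊢ˢ-lift S (⊢sub S dU) (eq-refl (⊢sub S dU))
    in ty-lam (⊢sub S dU) (⊢sub S' dT) (⊢sub S' d)
  ⊢sub {σ = σ} S (ty-app {T = T} {u = u} dU dT dt du) =
    let S' = ⊢ˢ-lift S (⊢sub S dU) (eq-refl (⊢sub S dU))
    in cast-ty (sym (sub-[] σ T u)) (ty-app (⊢sub S dU) (⊢sub S' dT) (⊢sub S dt) (⊢sub-arg S du))
  ⊢sub S (ty-conv d e) = ty-conv (⊢sub S d) (⊢sub-≡ S e)

  ⊢sub-arg : ∀ {Δ σ Γ t T a} → Δ ⊢ˢ σ ∶ Γ → Γ ⊢ᴱ t ∶[ a ] T → Δ ⊢ᴱ sub σ t ∶[ a ] sub σ T
  ⊢sub-arg S (∶rel d) = ∶rel (⊢sub S d)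
  ⊢sub-arg S (∶irr d) = ∶irr (⊢sub (⊢ˢ-⊕ S) d)

  ⊢sub-≡arg : ∀ {Δ σ Γ t t' T a} → Δ ⊢ˢ σ ∶ Γ → Γ ⊢ᴱ t ≡ t' ∶[ a ] T →
              Δ ⊢ᴱ sub σ t ≡ sub σ t' ∶[ a ] sub σ T
  ⊢sub-≡arg S (≡rel e)    = ≡rel (⊢sub-≡ S e)
  ⊢sub-≡arg S (≡irr d d') = ≡irr (⊢sub (⊢ˢ-⊕ S) d) (⊢sub (⊢ˢ-⊕ S) d')

  ⊢sub-≡ : ∀ {Δ σ Γ t t' T} → Δ ⊢ˢ σ ∶ Γ → Γ ⊢ᴱ t ≡ t' ∶ T → Δ ⊢ᴱ sub σ t ≡ sub σ t' ∶ sub σ T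
  ⊢sub-≡ {σ = σ} S (eq-β {T = T} {t = t} {u = u} dU d du) =
    let S' = ⊢ˢ-lift S (⊢sub S dU) (eq-refl (⊢sub S dU))
    in cast-eq refl (sym (sub-[] σ t u)) (sym (sub-[] σ T u))
               (eq-β (⊢sub S dU) (⊢sub S' d) (⊢sub-arg S du))
  ⊢sub-≡ {σ = σ} S (eq-η {t = t} d) =
    cast-eq refl (cong (λ f → lam _ _ (app _ f (var zero))) (wk-sub σ t)) refl (eq-η (⊢sub S d))
  ⊢sub-≡ S (eq-refl d)      = eq-refl (⊢sub S d)
  ⊢sub-≡ S (eq-sym e)       = eq-sym (⊢sub-≡ S e)
  ⊢sub-≡ S (eq-trans e e')  = eq-trans (⊢sub-≡ S e) (⊢sub-≡ S e')
  ⊢sub-≡ S (eq-pi dU eU eT) =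
    let S' = ⊢ˢ-lift S (⊢sub S dU) (eq-refl (⊢sub S dU))
    in eq-pi (⊢sub S dU) (⊢sub-≡ S eU) (⊢sub-≡ S' eT)
  ⊢sub-≡ S (eq-lam dU eU dT et) =
    let S' = ⊢ˢ-lift S (⊢sub S dU) (eq-refl (⊢sub S dU))
    in eq-lam (⊢sub S dU) (⊢sub-≡ S eU) (⊢sub S' dT) (⊢sub-≡ S' et)
  ⊢sub-≡ {σ = σ} S (eq-app {T = T} {u = u} dU dT et eu) =
    let S' = ⊢ˢ-lift S (⊢sub S dU) (eq-refl (⊢sub S dU))
    in cast-eq refl refl (sym (sub-[] σ T u))
               (eq-app (⊢sub S dU) (⊢sub S' dT) (⊢sub-≡ S et) (⊢sub-≡arg S eu))
  ⊢sub-≡ S (eq-conv e e')   = eq-conv (⊢sub-≡ S e) (⊢sub-≡ S e')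

⊢ˢ-id : ∀ {Γ} → ⊢ᴱ Γ → Γ ⊢ˢ var ∶ Γ
⊢ˢ-id p = mkSub p λ {_} {A} x → cast-arg (sym (sub-id A)) (⊢var-arg p x)

⊢ˢ-single : ∀ {Γ a u U} → ⊢ᴱ Γ → Γ ⊢ᴱ u ∶[ a ] U → Γ ⊢ˢ single u ∶ (Γ ▸ (a , U))
⊢ˢ-single {Γ} {a} {u} {U} p du = mkSub p ∋single
  where
  ∋single : ∀ {x A b} → (Γ ▸ (a , U)) ∋ x ∶ A ⟨ b ⟩ → Γ ⊢ᴱ single u x ∶[ b ] sub (single u) A
  ∋single here              = cast-arg (sym (wk-[] U u)) du
  ∋single (there {U = A} x) = cast-arg (sym (wk-[] A u)) (⊢var-arg p x)

ctx-conv : ∀ {Γ a U U' s t T} → Γ ⊢ᴱ U' ∶ sort s → Γ ⊢ᴱ U ≡ U' ∶ sort s →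
           (Γ ▸ (a , U)) ⊢ᴱ t ∶ T → (Γ ▸ (a , U')) ⊢ᴱ t ∶ T
ctx-conv {U = U} {t = t} {T} dU' e d =
  cast-tm (sub-id-lift t) (cast-ty (sub-id-lift T) (⊢sub S d))
  where
  S = ⊢ˢ-lift (⊢ˢ-id (ctx-wf dU')) dU' (cast-eq refl (sym (sub-id U)) refl (eq-sym e))
  sub-id-lift : ∀ t → sub (liftSub var) t ≐ t
  sub-id-lift t = trans (sub-cong liftSub-var t) (sub-id t)

record _⊢ˢ_≡_∶_ (Δ : Ctx) (σ σ' : ℕ → Tm) (Γ : Ctx) : Set where
  constructor mkSubEq
  field
    ≡-left  : Δ ⊢ˢ σ ∶ Γ
    ≡-right : Δ ⊢ˢ σ' ∶ Γ
    ≡-∋     : ∀ {x A} → Γ ∋ x ∶ A ⟨ rel ⟩ → Δ ⊢ᴱ σ x ≡ σ' x ∶ sub σ A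
open _⊢ˢ_≡_∶_

⊢ˢ≡-lift : ∀ {Δ σ σ' Γ a U s} → Δ ⊢ˢ σ ≡ σ' ∶ Γ →
           Δ ⊢ᴱ sub σ U ∶ sort s → Δ ⊢ᴱ sub σ U ≡ sub σ' U ∶ sort s →
           (Δ ▸ (a , sub σ U)) ⊢ˢ liftSub σ ≡ liftSub σ' ∶ (Γ ▸ (a , U))
⊢ˢ≡-lift {Δ} {σ} {σ'} {Γ} {a} {U} E dU eU =
  mkSubEq (⊢ˢ-lift (≡-left E) dU (eq-refl dU)) (⊢ˢ-lift (≡-right E) dU eU) ∋lift
  where
  p : ⊢ᴱ (Δ ▸ (a , sub σ U))
  p = ⊢▸ (sub-wf (≡-left E)) dU
  ∋lift : ∀ {x A} → (Γ ▸ (a , U)) ∋ x ∶ A ⟨ rel ⟩ →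
          (Δ ▸ (a , sub σ U)) ⊢ᴱ liftSub σ x ≡ liftSub σ' x ∶ sub (liftSub σ) A
  ∋lift here              = cast-eq refl refl (wk-sub σ U) (eq-refl (ty-var p here))
  ∋lift (there {U = A} x) = cast-eq refl refl (wk-sub σ A) (⊢wk-≡ p (≡-∋ E x))

⊢ˢ≡-single : ∀ {Γ a u u' U} → ⊢ᴱ Γ → Γ ⊢ᴱ u ∶[ a ] U → Γ ⊢ᴱ u' ∶[ a ] U →
             Γ ⊢ᴱ u ≡ u' ∶[ a ] U → Γ ⊢ˢ single u ≡ single u' ∶ (Γ ▸ (a , U))
⊢ˢ≡-single {Γ} {a} {u} {u'} {U} p du du' eu =
  mkSubEq (⊢ˢ-single p du) (⊢ˢ-single p du') (∋single eu)
  where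
  ∋single : ∀ {x A} → Γ ⊢ᴱ u ≡ u' ∶[ a ] U → (Γ ▸ (a , U)) ∋ x ∶ A ⟨ rel ⟩ →
            Γ ⊢ᴱ single u x ≡ single u' x ∶ sub (single u) A
  ∋single (≡rel e) here = cast-eq refl refl (sym (wk-[] U u)) e
  ∋single _ (there {U = A} x) =
    cast-eq refl refl (sym (wk-[] A u)) (eq-refl (ty-var p (∋rel⇒∋ x)))

mutual
  ⊢sub-cong : ∀ {Δ σ σ' Γ t T} → Δ ⊢ˢ σ ≡ σ' ∶ Γ → Γ ⊢ᴱ t ∶ T → Δ ⊢ᴱ sub σ t ≡ sub σ' t ∶ sub σ T
  ⊢sub-cong E (ty-sort _)   = eq-refl (ty-sort (sub-wf (≡-left E)))
  ⊢sub-cong E (ty-pi dU dT) =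
    let dσU = ⊢sub (≡-left E) dU
    in eq-pi dσU (⊢sub-cong E dU) (⊢sub-cong (⊢ˢ≡-lift E dσU (⊢sub-cong E dU)) dT)
  ⊢sub-cong E (ty-var _ x)  = ≡-∋ E (∋⇒∋rel x)
  ⊢sub-cong E (ty-lam dU dT d) =
    let dσU = ⊢sub (≡-left E) dU
    in eq-lam dσU (⊢sub-cong E dU) (⊢sub (⊢ˢ-lift (≡-left E) dσU (eq-refl dσU)) dT)
              (⊢sub-cong (⊢ˢ≡-lift E dσU (⊢sub-cong E dU)) d)
  ⊢sub-cong {σ = σ} E (ty-app {T = T} {u = u} dU dT dt du) =
    let dσU = ⊢sub (≡-left E) dU
    in cast-eq refl refl (sym (sub-[] σ T u))
         (eq-app dσU (⊢sub (⊢ˢ-lift (≡-left E) dσU (eq-refl dσU)) dT)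
                 (⊢sub-cong E dt) (⊢sub-cong-arg E dU du))
  ⊢sub-cong E (ty-conv d e) = eq-conv (⊢sub-cong E d) (⊢sub-≡ (≡-left E) e)

  -- An irrelevant argument needs no equation, only a typing of sub σ' u at
  -- sub σ U; the premise on U provides the conversion.
  ⊢sub-cong-arg : ∀ {Δ σ σ' Γ u U a s} → Δ ⊢ˢ σ ≡ σ' ∶ Γ → Γ ⊢ᴱ U ∶ sort s →
                  Γ ⊢ᴱ u ∶[ a ] U → Δ ⊢ᴱ sub σ u ≡ sub σ' u ∶[ a ] sub σ U
  ⊢sub-cong-arg E dU (∶rel d) = ≡rel (⊢sub-cong E d)
  ⊢sub-cong-arg E dU (∶irr d) =
    ≡irr (⊢sub (⊢ˢ-⊕ (≡-left E)) d)
         (ty-conv (⊢sub (⊢ˢ-⊕ (≡-right E)) d) (resurrect-≡ (eq-sym (⊢sub-cong E dU))))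

∋-valid : ∀ {Γ x U} → ⊢ᴱ Γ → Γ ∋ x ∶ U → Γ ⊢ᴱtype U
∋-valid (⊢▸ p dB) here      = _ , ⊢wk (⊢▸ p dB) dB
∋-valid (⊢▸ p dB) (there x) = map₂ (⊢wk (⊢▸ p dB)) (∋-valid p x)

⊢η-expansion : ∀ {Γ a s s' U T t X} → Γ ⊢ᴱ t ∶ pi a s s' U T → Γ ⊢ᴱ pi a s s' U T ∶ X →
               Γ ⊢ᴱ lam a U (app a (wk t) (var zero)) ∶ pi a s s' U T
⊢η-expansion {T = T} dt dΠ =
  ty-lam dU dT (cast-ty (ren-liftRen-suc-[var0] T)
                        (ty-app dwU dwT (⊢wk p dt) (⊢var-arg p here)))
  where
  dU = proj₁ (pi-inv dΠ)
  dT = proj₂ (pi-inv dΠ)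
  p = ⊢▸ (ctx-wf dt) dU
  dwU = proj₁ (pi-inv (⊢wk p dΠ))
  dwT = proj₂ (pi-inv (⊢wk p dΠ))

mutual
  valid : ∀ {Γ t T} → Γ ⊢ᴱ t ∶ T → Γ ⊢ᴱtype T
  valid (ty-sort p)          = _ , ty-sort p
  valid (ty-pi dU _)         = _ , ty-sort (ctx-wf dU)
  valid (ty-var p x)         = ∋-valid p x
  valid (ty-lam dU dT _)     = _ , ty-pi dU dT
  valid (ty-app dU dT _ du)  = _ , ⊢sub (⊢ˢ-single (ctx-wf dU) du) dT
  valid (ty-conv _ e)        = _ , proj₂ (valid-≡ e)

  valid-≡arg : ∀ {Γ a u u' U} → Γ ⊢ᴱ u ≡ u' ∶[ a ] U → (Γ ⊢ᴱ u ∶[ a ] U) × (Γ ⊢ᴱ u' ∶[ a ] U)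
  valid-≡arg (≡rel e)    = map ∶rel ∶rel (valid-≡ e)
  valid-≡arg (≡irr d d') = ∶irr d , ∶irr d'

  valid-≡ : ∀ {Γ t t' T} → Γ ⊢ᴱ t ≡ t' ∶ T → (Γ ⊢ᴱ t ∶ T) × (Γ ⊢ᴱ t' ∶ T)
  valid-≡ (eq-β dU d du) =
    let dT = proj₂ (valid d)
    in ty-app dU dT (ty-lam dU dT d) du , ⊢sub (⊢ˢ-single (ctx-wf dU) du) d
  valid-≡ (eq-η dt)        = dt , ⊢η-expansion dt (proj₂ (valid dt))
  valid-≡ (eq-refl d)      = d , d
  valid-≡ (eq-sym e)       = proj₂ (valid-≡ e) , proj₁ (valid-≡ e)
  valid-≡ (eq-trans e e')  = proj₁ (valid-≡ e) , proj₂ (valid-≡ e')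
  valid-≡ (eq-pi dU eU eT) =
    let dU' = proj₂ (valid-≡ eU)
    in ty-pi dU (proj₁ (valid-≡ eT)) , ty-pi dU' (ctx-conv dU' eU (proj₂ (valid-≡ eT)))
  valid-≡ (eq-lam dU eU dT et) =
    let dU' = proj₂ (valid-≡ eU)
        dT' = ctx-conv dU' eU dT
    in ty-lam dU dT (proj₁ (valid-≡ et)) ,
       ty-conv (ty-lam dU' dT' (ctx-conv dU' eU (proj₂ (valid-≡ et))))
               (eq-pi dU' (eq-sym eU) (eq-refl dT'))
  valid-≡ (eq-app dU dT et eu) =
    let du , du' = valid-≡arg eu
    in ty-app dU dT (proj₁ (valid-≡ et)) du ,
       ty-conv (ty-app dU dT (proj₂ (valid-≡ et)) du')
               (eq-sym (⊢sub-cong (⊢ˢ≡-single (ctx-wf dU) du du' eu) dT))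
  valid-≡ (eq-conv e e')   = map (λ d → ty-conv d e') (λ d → ty-conv d e') (valid-≡ e)

mutual
  toᴱ-wf : ∀ {Γ} → ⊢ Γ → ⊢ᴱ Γ
  toᴱ-wf ⊢ε       = ⊢ε
  toᴱ-wf (⊢▸ p d) = ⊢▸ (toᴱ-wf p) (toᴱ d)

  toᴱ-arg : ∀ {Γ u a U} → Γ ⊢ u ∶[ a ] U → Γ ⊢ᴱ u ∶[ a ] U
  toᴱ-arg (∶rel d) = ∶rel (toᴱ d)
  toᴱ-arg (∶irr d) = ∶irr (toᴱ d)

  toᴱ-≡arg : ∀ {Γ u u' a U} → Γ ⊢ u ≡ u' ∶[ a ] U → Γ ⊢ᴱ u ≡ u' ∶[ a ] U
  toᴱ-≡arg (≡rel e)    = ≡rel (toᴱ-≡ e)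
  toᴱ-≡arg (≡irr d d') = ≡irr (toᴱ d) (toᴱ d')

  toᴱ : ∀ {Γ t T} → Γ ⊢ t ∶ T → Γ ⊢ᴱ t ∶ T
  toᴱ (ty-sort p)    = ty-sort (toᴱ-wf p)
  toᴱ (ty-pi dU dT)  = ty-pi (toᴱ dU) (toᴱ dT)
  toᴱ (ty-var p x)   = ty-var (toᴱ-wf p) x
  toᴱ (ty-lam d dΠ)  = let dU , dT = pi-inv (toᴱ dΠ) in ty-lam dU dT (toᴱ d)
  toᴱ (ty-app dt du) =
    let dt' = toᴱ dt
        dU , dT = pi-inv (proj₂ (valid dt'))
    in ty-app dU dT dt' (toᴱ-arg du)
  toᴱ (ty-conv d e)  = ty-conv (toᴱ d) (toᴱ-≡ e)

  toᴱ-≡ : ∀ {Γ t t' T} → Γ ⊢ t ≡ t' ∶ T → Γ ⊢ᴱ t ≡ t' ∶ T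
  toᴱ-≡ (eq-β d du) = let d' = toᴱ d in eq-β (proj₂ (▸-wf-inv (ctx-wf d'))) d' (toᴱ-arg du)
  toᴱ-≡ (eq-η d)         = eq-η (toᴱ d)
  toᴱ-≡ (eq-refl d)      = eq-refl (toᴱ d)
  toᴱ-≡ (eq-sym e)       = eq-sym (toᴱ-≡ e)
  toᴱ-≡ (eq-trans e e')  = eq-trans (toᴱ-≡ e) (toᴱ-≡ e')
  toᴱ-≡ (eq-pi eU eT)    = let eU' = toᴱ-≡ eU in eq-pi (proj₁ (valid-≡ eU')) eU' (toᴱ-≡ eT)
  toᴱ-≡ (eq-lam eU dT et) =
    let eU' = toᴱ-≡ eU in eq-lam (proj₁ (valid-≡ eU')) eU' (toᴱ dT) (toᴱ-≡ et)
  toᴱ-≡ (eq-app et eu) =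
    let et' = toᴱ-≡ et
        dU , dT = pi-inv (proj₂ (valid (proj₁ (valid-≡ et'))))
    in eq-app dU dT et' (toᴱ-≡arg eu)
  toᴱ-≡ (eq-conv e e')   = eq-conv (toᴱ-≡ e) (toᴱ-≡ e')

mutual
  fromᴱ-wf : ∀ {Γ} → ⊢ᴱ Γ → ⊢ Γ
  fromᴱ-wf ⊢ε       = ⊢ε
  fromᴱ-wf (⊢▸ p d) = ⊢▸ (fromᴱ-wf p) (fromᴱ d)

  fromᴱ-arg : ∀ {Γ u a U} → Γ ⊢ᴱ u ∶[ a ] U → Γ ⊢ u ∶[ a ] U
  fromᴱ-arg (∶rel d) = ∶rel (fromᴱ d)
  fromᴱ-arg (∶irr d) = ∶irr (fromᴱ d)

  fromᴱ-≡arg : ∀ {Γ u u' a U} → Γ ⊢ᴱ u ≡ u' ∶[ a ] U → Γ ⊢ u ≡ u' ∶[ a ] U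
  fromᴱ-≡arg (≡rel e)    = ≡rel (fromᴱ-≡ e)
  fromᴱ-≡arg (≡irr d d') = ≡irr (fromᴱ d) (fromᴱ d')

  fromᴱ : ∀ {Γ t T} → Γ ⊢ᴱ t ∶ T → Γ ⊢ t ∶ T
  fromᴱ (ty-sort p)         = ty-sort (fromᴱ-wf p)
  fromᴱ (ty-pi dU dT)       = ty-pi (fromᴱ dU) (fromᴱ dT)
  fromᴱ (ty-var p x)        = ty-var (fromᴱ-wf p) x
  fromᴱ (ty-lam dU dT d)    = ty-lam (fromᴱ d) (ty-pi (fromᴱ dU) (fromᴱ dT))
  fromᴱ (ty-app _ _ dt du)  = ty-app (fromᴱ dt) (fromᴱ-arg du)
  fromᴱ (ty-conv d e)       = ty-conv (fromᴱ d) (fromᴱ-≡ e)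

  fromᴱ-≡ : ∀ {Γ t t' T} → Γ ⊢ᴱ t ≡ t' ∶ T → Γ ⊢ t ≡ t' ∶ T
  fromᴱ-≡ (eq-β _ d du)        = eq-β (fromᴱ d) (fromᴱ-arg du)
  fromᴱ-≡ (eq-η d)             = eq-η (fromᴱ d)
  fromᴱ-≡ (eq-refl d)          = eq-refl (fromᴱ d)
  fromᴱ-≡ (eq-sym e)           = eq-sym (fromᴱ-≡ e)
  fromᴱ-≡ (eq-trans e e')      = eq-trans (fromᴱ-≡ e) (fromᴱ-≡ e')
  fromᴱ-≡ (eq-pi _ eU eT)      = eq-pi (fromᴱ-≡ eU) (fromᴱ-≡ eT)
  fromᴱ-≡ (eq-lam _ eU dT et)  = eq-lam (fromᴱ-≡ eU) (fromᴱ dT) (fromᴱ-≡ et)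
  fromᴱ-≡ (eq-app _ _ et eu)   = eq-app (fromᴱ-≡ et) (fromᴱ-≡arg eu)
  fromᴱ-≡ (eq-conv e e')       = eq-conv (fromᴱ-≡ e) (fromᴱ-≡ e')

corollary4p17 : (∀ {Γ t T} → Γ ⊢ t ∶ T → Γ ⊢type T)
                × (∀ {Γ t t' T} → Γ ⊢ t ≡ t' ∶ T → (Γ ⊢ t ∶ T) × (Γ ⊢ t' ∶ T))
corollary4p17 =
  (λ d → map₂ fromᴱ (valid (toᴱ d))) ,
  (λ e → map fromᴱ fromᴱ (valid-≡ (toᴱ-≡ e)))
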